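{- Let $k\ge0$ and let $T$ be a theory (in the language of $\mathsf{HA}$) containing $\mathsf{HA}$. If $T$ is closed under $\mathrm{DNE\text{ - }R}(\Sigma_{k+1})$, then $T\vdash\mathrm{LEM}(\Sigma_k)$.
   Context: $\mathsf{HA}$ is intuitionistic first-order arithmetic with function symbols for all primitive recursive functions and logical constants $\forall,\exists,\to,\land,\lor,\perp$ ($\neg\varphi:\equiv\varphi\to\perp$). $\Sigma_0=\Pi_0$ = quantifier-free formulas; $\Sigma_{k+1}$ = formulas $\exists x_1\cdots\exists x_n\varphi$ with $\varphi\in\Pi_k$; $\Pi_{k+1}$ = formulas $\forall x_1\cdots\forall x_n\varphi$ with $\varphi\in\Sigma_k$. $T$ is closed under $\mathrm{DNE\text{ - }R}(\Gamma)$ if $T\vdash\neg\neg\varphi$ implies $T\vdash\varphi$ for every $\varphi\in\Gamma$ (possibly with free variables). $\mathrm{LEM}(\Sigma_k)$ is the scheme $\varphi\lor\neg\varphi$, $\varphi\in\Sigma_k$. -}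

module Defs where

open import Data.Nat using (ℕ; zero; suc)
open import Data.Fin using (Fin)
open import Data.Vec using (Vec; []; _∷_; lookup; map)

data PR : ℕ → Set where
  Zr   : PR 0
  Sc   : PR 1
  Pj   : ∀ {n} → Fin n → PR n
  Cmp  : ∀ {m n} → PR m → Vec (PR n) m → PR n
  Rec  : ∀ {n} → PR n → PR (suc (suc n)) → PR (suc n)
         -- Rec f g (0, xs) = f xs ; Rec f g (y+1, xs) = g (Rec f g (y, xs), y, xs)

data Term : Set where
  var : ℕ → Term
  app : ∀ {n} → PR n → Vec Term n → Term

𝟘 : Term
𝟘 = app Zr []

𝕊 : Term → Term
𝕊 t = app Sc (t ∷ [])

Subst : Set
Subst = ℕ → Term

mutual
  substT : Subst → Term → Term
  substT σ (var x)    = σ x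
  substT σ (app f ts) = app f (substTs σ ts)

  substTs : ∀ {n} → Subst → Vec Term n → Vec Term n
  substTs σ []       = []
  substTs σ (t ∷ ts) = substT σ t ∷ substTs σ ts

shiftT : Term → Term
shiftT = substT (λ x → var (suc x))

lift : Subst → Subst
lift σ zero    = var zero
lift σ (suc x) = shiftT (σ x)

infix  7 _≐_
infixr 6 _∧'_
infixr 5 _∨'_
infixr 4 _⇒_

data Formula : Set where
  _≐_  : Term → Term → Formula
  ⊥'   : Formula
  _∧'_ : Formula → Formula → Formula
  _∨'_ : Formula → Formula → Formula
  _⇒_  : Formula → Formula → Formula
  ∀'   : Formula → Formula
  ∃'   : Formula → Formula

¬' : Formula → Formula
¬' φ = φ ⇒ ⊥'

substF : Subst → Formula → Formula
substF σ (t ≐ s)   = substT σ t ≐ substT σ s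
substF σ ⊥'        = ⊥'
substF σ (φ ∧' ψ)  = substF σ φ ∧' substF σ ψ
substF σ (φ ∨' ψ)  = substF σ φ ∨' substF σ ψ
substF σ (φ ⇒ ψ)   = substF σ φ ⇒ substF σ ψ
substF σ (∀' φ)    = ∀' (substF (lift σ) φ)
substF σ (∃' φ)    = ∃' (substF (lift σ) φ)

shiftF : Formula → Formula
shiftF = substF (λ x → var (suc x))

-- φ[t/0] (the other free variables are renumbered down)
_[_] : Formula → Term → Formula
φ [ t ] = substF σ φ
  where
  σ : Subst
  σ zero    = t
  σ (suc x) = var x

succ0 : Formula → Formula
succ0 = substF σ
  where
  σ : Subst
  σ zero    = 𝕊 (var zero)
  σ (suc x) = var (suc x)

data QF : Formula → Set where
  qf-eq : ∀ {t s} → QF (t ≐ s)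
  qf-⊥  : QF ⊥'
  qf-∧  : ∀ {φ ψ} → QF φ → QF ψ → QF (φ ∧' ψ)
  qf-∨  : ∀ {φ ψ} → QF φ → QF ψ → QF (φ ∨' ψ)
  qf-⇒  : ∀ {φ ψ} → QF φ → QF ψ → QF (φ ⇒ ψ)

mutual
  data Σ-form : ℕ → Formula → Set where
    Σ0  : ∀ {φ} → QF φ → Σ-form 0 φ
    Σ-Π : ∀ {k φ} → Π-form k φ → Σ-form (suc k) φ
    Σ-∃ : ∀ {k φ} → Σ-form (suc k) φ → Σ-form (suc k) (∃' φ)

  data Π-form : ℕ → Formula → Set where
    Π0  : ∀ {φ} → QF φ → Π-form 0 φ
    Π-Σ : ∀ {k φ} → Σ-form k φ → Π-form (suc k) φ
    Π-∀ : ∀ {k φ} → Π-form (suc k) φ → Π-form (suc k) (∀' φ)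

-- Non-logical axioms of HA (open formulas; free variables are read
-- universally, via the generalisation rule below).

data HA-Ax : Formula → Set where
  ax-succ≠0 : ∀ t → HA-Ax (¬' (𝕊 t ≐ 𝟘))
  ax-succInj : ∀ t s → HA-Ax ((𝕊 t ≐ 𝕊 s) ⇒ (t ≐ s))
  ax-proj : ∀ {n} (i : Fin n) (ts : Vec Term n) →
            HA-Ax (app (Pj i) ts ≐ lookup ts i)
  ax-comp : ∀ {m n} (f : PR m) (gs : Vec (PR n) m) (ts : Vec Term n) →
            HA-Ax (app (Cmp f gs) ts ≐ app f (map (λ g → app g ts) gs))
  ax-rec0 : ∀ {n} (f : PR n) (g : PR (suc (suc n))) (ts : Vec Term n) →
            HA-Ax (app (Rec f g) (𝟘 ∷ ts) ≐ app f ts)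
  ax-recS : ∀ {n} (f : PR n) (g : PR (suc (suc n))) (t : Term) (ts : Vec Term n) →
            HA-Ax (app (Rec f g) (𝕊 t ∷ ts) ≐ app g (app (Rec f g) (t ∷ ts) ∷ t ∷ ts))
  ax-ind : ∀ φ → HA-Ax ((φ [ 𝟘 ] ∧' ∀' (φ ⇒ succ0 φ)) ⇒ ∀' φ)

Theory : Set₁
Theory = Formula → Set

infix 2 _⊢_

data _⊢_ (T : Theory) : Formula → Set where
  ax    : ∀ {φ} → T φ → T ⊢ φ
  K     : ∀ {φ ψ} → T ⊢ φ ⇒ ψ ⇒ φ
  S     : ∀ {φ ψ χ} → T ⊢ (φ ⇒ ψ ⇒ χ) ⇒ (φ ⇒ ψ) ⇒ φ ⇒ χ
  ∧I    : ∀ {φ ψ} → T ⊢ φ ⇒ ψ ⇒ φ ∧' ψ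
  ∧E₁   : ∀ {φ ψ} → T ⊢ φ ∧' ψ ⇒ φ
  ∧E₂   : ∀ {φ ψ} → T ⊢ φ ∧' ψ ⇒ ψ
  ∨I₁   : ∀ {φ ψ} → T ⊢ φ ⇒ φ ∨' ψ
  ∨I₂   : ∀ {φ ψ} → T ⊢ ψ ⇒ φ ∨' ψ
  ∨E    : ∀ {φ ψ χ} → T ⊢ (φ ⇒ χ) ⇒ (ψ ⇒ χ) ⇒ φ ∨' ψ ⇒ χ
  efq   : ∀ {φ} → T ⊢ ⊥' ⇒ φ
  ∀E    : ∀ {φ} t → T ⊢ ∀' φ ⇒ φ [ t ]
  ∃I    : ∀ {φ} t → T ⊢ φ [ t ] ⇒ ∃' φ
  refl≐ : ∀ t → T ⊢ t ≐ t
  subst≐ : ∀ φ t s → T ⊢ (t ≐ s) ⇒ φ [ t ] ⇒ φ [ s ]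
  mp    : ∀ {φ ψ} → T ⊢ φ ⇒ ψ → T ⊢ φ → T ⊢ ψ
  gen   : ∀ {φ} → T ⊢ φ → T ⊢ ∀' φ
  ∀I    : ∀ {φ ψ} → T ⊢ shiftF ψ ⇒ φ → T ⊢ ψ ⇒ ∀' φ
  ∃E    : ∀ {φ ψ} → T ⊢ φ ⇒ shiftF ψ → T ⊢ ∃' φ ⇒ ψ

ContainsHA : Theory → Set
ContainsHA T = ∀ φ → HA-Ax φ → T ⊢ φ

ClosedDNE-R : Theory → (Formula → Set) → Set
ClosedDNE-R T Γ = ∀ φ → Γ φ → T ⊢ ¬' (¬' φ) → T ⊢ φ

ProvesLEM : Theory → (Formula → Set) → Set
ProvesLEM T Γ = ∀ φ → Γ φ → T ⊢ φ ∨' ¬' φ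

-- By induction on k, every Σₖ formula φ satisfies φ ∨ neg φ, where neg is
-- the prenex classical negation (dual quantifiers, negated matrix).  The
-- only real case is φ = ∃y ψ with ψ ∈ Σₖ₊₁ and ψ ∨ neg ψ already known.
-- The disjunction ∃y ψ ∨ ∀y neg ψ is provably equivalent to the Σₖ₊₂ formula
--   ∃y ∃x ((x = 0 → ψ) ∧ (x ≠ 0 → ∀y neg ψ))
-- (after prenexing), whose double negation follows from ¬¬(∃y ψ ∨ ¬∃y ψ)
-- and ¬∃y ψ → ∀y neg ψ; closure under DNE-R(Σₖ₊₂) removes it.  Quantifier-free
-- LEM, needed for x = 0 and for neg (neg χ) → χ, is itself an instance of
-- DNE-R(Σₖ₊₁).

module Submission where

open import Defs
open import Data.Nat using (ℕ; zero; suc)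
open import Data.Product using (∃-syntax; _×_; _,_)
open import Data.Vec using (Vec; []; _∷_)
open import Relation.Binary.PropositionalEquality
  using (_≡_; refl; sym; trans; cong; cong₂; subst)

↑ : Subst
↑ x = var (suc x)

_⊙_ : Subst → Subst → Subst
(σ ⊙ τ) x = substT σ (τ x)

mutual
  substT-cong : ∀ {σ τ} → (∀ x → σ x ≡ τ x) → ∀ t → substT σ t ≡ substT τ t
  substT-cong e (var x)    = e x
  substT-cong e (app f ts) = cong (app f) (substTs-cong e ts)

  substTs-cong : ∀ {n σ τ} → (∀ x → σ x ≡ τ x) →
                 (ts : Vec Term n) → substTs σ ts ≡ substTs τ ts
  substTs-cong e []       = refl
  substTs-cong e (t ∷ ts) = cong₂ _∷_ (substT-cong e t) (substTs-cong e ts)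

lift-cong : ∀ {σ τ} → (∀ x → σ x ≡ τ x) → ∀ x → lift σ x ≡ lift τ x
lift-cong e zero    = refl
lift-cong e (suc x) = cong shiftT (e x)

substF-cong : ∀ {σ τ} → (∀ x → σ x ≡ τ x) → ∀ φ → substF σ φ ≡ substF τ φ
substF-cong e (t ≐ s)  = cong₂ _≐_ (substT-cong e t) (substT-cong e s)
substF-cong e ⊥'       = refl
substF-cong e (φ ∧' ψ) = cong₂ _∧'_ (substF-cong e φ) (substF-cong e ψ)
substF-cong e (φ ∨' ψ) = cong₂ _∨'_ (substF-cong e φ) (substF-cong e ψ)
substF-cong e (φ ⇒ ψ)  = cong₂ _⇒_ (substF-cong e φ) (substF-cong e ψ)
substF-cong e (∀' φ)   = cong ∀' (substF-cong (lift-cong e) φ)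
substF-cong e (∃' φ)   = cong ∃' (substF-cong (lift-cong e) φ)

mutual
  substT-⊙ : ∀ {σ τ} t → substT σ (substT τ t) ≡ substT (σ ⊙ τ) t
  substT-⊙ (var x)    = refl
  substT-⊙ (app f ts) = cong (app f) (substTs-⊙ ts)

  substTs-⊙ : ∀ {n σ τ} (ts : Vec Term n) →
              substTs σ (substTs τ ts) ≡ substTs (σ ⊙ τ) ts
  substTs-⊙ []       = refl
  substTs-⊙ (t ∷ ts) = cong₂ _∷_ (substT-⊙ t) (substTs-⊙ ts)

lift-⊙ : ∀ σ τ x → (lift σ ⊙ lift τ) x ≡ lift (σ ⊙ τ) x
lift-⊙ σ τ zero    = refl
lift-⊙ σ τ (suc x) = trans (substT-⊙ {lift σ} {↑} (τ x)) (sym (substT-⊙ {↑} {σ} (τ x)))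

substF-⊙ : ∀ {σ τ} φ → substF σ (substF τ φ) ≡ substF (σ ⊙ τ) φ
substF-⊙ (t ≐ s)  = cong₂ _≐_ (substT-⊙ t) (substT-⊙ s)
substF-⊙ ⊥'       = refl
substF-⊙ (φ ∧' ψ) = cong₂ _∧'_ (substF-⊙ φ) (substF-⊙ ψ)
substF-⊙ (φ ∨' ψ) = cong₂ _∨'_ (substF-⊙ φ) (substF-⊙ ψ)
substF-⊙ (φ ⇒ ψ)  = cong₂ _⇒_ (substF-⊙ φ) (substF-⊙ ψ)
substF-⊙ {σ} {τ} (∀' φ) = cong ∀' (trans (substF-⊙ φ) (substF-cong (lift-⊙ σ τ) φ))
substF-⊙ {σ} {τ} (∃' φ) = cong ∃' (trans (substF-⊙ φ) (substF-cong (lift-⊙ σ τ) φ))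

mutual
  substT-id : ∀ {σ} → (∀ x → σ x ≡ var x) → ∀ t → substT σ t ≡ t
  substT-id e (var x)    = e x
  substT-id e (app f ts) = cong (app f) (substTs-id e ts)

  substTs-id : ∀ {n σ} → (∀ x → σ x ≡ var x) → (ts : Vec Term n) → substTs σ ts ≡ ts
  substTs-id e []       = refl
  substTs-id e (t ∷ ts) = cong₂ _∷_ (substT-id e t) (substTs-id e ts)

lift-id : ∀ {σ} → (∀ x → σ x ≡ var x) → ∀ x → lift σ x ≡ var x
lift-id e zero    = refl
lift-id e (suc x) = cong shiftT (e x)

substF-id : ∀ {σ} → (∀ x → σ x ≡ var x) → ∀ φ → substF σ φ ≡ φ
substF-id e (t ≐ s)  = cong₂ _≐_ (substT-id e t) (substT-id e s)
substF-id e ⊥'       = refl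
substF-id e (φ ∧' ψ) = cong₂ _∧'_ (substF-id e φ) (substF-id e ψ)
substF-id e (φ ∨' ψ) = cong₂ _∨'_ (substF-id e φ) (substF-id e ψ)
substF-id e (φ ⇒ ψ)  = cong₂ _⇒_ (substF-id e φ) (substF-id e ψ)
substF-id e (∀' φ)   = cong ∀' (substF-id (lift-id e) φ)
substF-id e (∃' φ)   = cong ∃' (substF-id (lift-id e) φ)

shiftF-[] : ∀ φ t → shiftF φ [ t ] ≡ φ
shiftF-[] φ t = trans (substF-⊙ φ) (substF-id (λ _ → refl) φ)

lift↑-[var0] : ∀ φ → substF (lift ↑) φ [ var 0 ] ≡ φ
lift↑-[var0] φ = trans (substF-⊙ φ) (substF-id (λ { zero → refl ; (suc x) → refl }) φ)

lift↑²-[var1] : ∀ φ → substF (lift ↑) (substF (lift ↑) φ) [ var 1 ] ≡ shiftF φ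
lift↑²-[var1] φ =
  trans (cong (_[ var 1 ]) (substF-⊙ φ))
        (trans (substF-⊙ φ) (substF-cong (λ { zero → refl ; (suc x) → refl }) φ))

substF-lift-shiftF : ∀ σ φ → substF (lift σ) (shiftF φ) ≡ shiftF (substF σ φ)
substF-lift-shiftF σ φ = trans (substF-⊙ φ) (sym (substF-⊙ φ))

guard : Formula → Formula → Formula
guard D (∃' A)   = ∃' (guard (shiftF D) A)
guard D (∀' A)   = ∀' (guard (shiftF D) A)
guard D (t ≐ s)  = D ⇒ t ≐ s
guard D ⊥'       = D ⇒ ⊥'
guard D (A ∧' B) = D ⇒ A ∧' B
guard D (A ∨' B) = D ⇒ A ∨' B
guard D (A ⇒ B)  = D ⇒ (A ⇒ B)

neg : Formula → Formula
neg (∃' A)   = ∀' (neg A)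
neg (∀' A)   = ∃' (neg A)
neg (t ≐ s)  = ¬' (t ≐ s)
neg ⊥'       = ¬' ⊥'
neg (A ∧' B) = ¬' (A ∧' B)
neg (A ∨' B) = ¬' (A ∨' B)
neg (A ⇒ B)  = ¬' (A ⇒ B)

guard-QF : ∀ {D A} → QF A → guard D A ≡ (D ⇒ A)
guard-QF qf-eq       = refl
guard-QF qf-⊥        = refl
guard-QF (qf-∧ _ _)  = refl
guard-QF (qf-∨ _ _)  = refl
guard-QF (qf-⇒ _ _)  = refl

neg-QF : ∀ {A} → QF A → neg A ≡ ¬' A
neg-QF qf-eq       = refl
neg-QF qf-⊥        = refl
neg-QF (qf-∧ _ _)  = refl
neg-QF (qf-∨ _ _)  = refl
neg-QF (qf-⇒ _ _)  = refl

substF-guard : ∀ σ D A → substF σ (guard D A) ≡ guard (substF σ D) (substF σ A)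
substF-guard σ D (∃' A) = cong ∃' (trans (substF-guard (lift σ) (shiftF D) A)
  (cong (λ E → guard E (substF (lift σ) A)) (substF-lift-shiftF σ D)))
substF-guard σ D (∀' A) = cong ∀' (trans (substF-guard (lift σ) (shiftF D) A)
  (cong (λ E → guard E (substF (lift σ) A)) (substF-lift-shiftF σ D)))
substF-guard σ D (t ≐ s)  = refl
substF-guard σ D ⊥'       = refl
substF-guard σ D (A ∧' B) = refl
substF-guard σ D (A ∨' B) = refl
substF-guard σ D (A ⇒ B)  = refl

QF-substF : ∀ σ {φ} → QF φ → QF (substF σ φ)
QF-substF σ qf-eq      = qf-eq
QF-substF σ qf-⊥       = qf-⊥
QF-substF σ (qf-∧ a b) = qf-∧ (QF-substF σ a) (QF-substF σ b)
QF-substF σ (qf-∨ a b) = qf-∨ (QF-substF σ a) (QF-substF σ b)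
QF-substF σ (qf-⇒ a b) = qf-⇒ (QF-substF σ a) (QF-substF σ b)

mutual
  Σ-substF : ∀ σ {m φ} → Σ-form m φ → Σ-form m (substF σ φ)
  Σ-substF σ (Σ0 q)  = Σ0 (QF-substF σ q)
  Σ-substF σ (Σ-Π p) = Σ-Π (Π-substF σ p)
  Σ-substF σ (Σ-∃ s) = Σ-∃ (Σ-substF (lift σ) s)

  Π-substF : ∀ σ {m φ} → Π-form m φ → Π-form m (substF σ φ)
  Π-substF σ (Π0 q)  = Π0 (QF-substF σ q)
  Π-substF σ (Π-Σ s) = Π-Σ (Σ-substF σ s)
  Π-substF σ (Π-∀ p) = Π-∀ (Π-substF (lift σ) p)

mutual
  Σ-suc : ∀ {m φ} → Σ-form m φ → Σ-form (suc m) φ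
  Σ-suc (Σ0 q)  = Σ-Π (Π0 q)
  Σ-suc (Σ-Π p) = Σ-Π (Π-suc p)
  Σ-suc (Σ-∃ s) = Σ-∃ (Σ-suc s)

  Π-suc : ∀ {m φ} → Π-form m φ → Π-form (suc m) φ
  Π-suc (Π0 q)  = Π-Σ (Σ0 q)
  Π-suc (Π-Σ s) = Π-Σ (Σ-suc s)
  Π-suc (Π-∀ p) = Π-∀ (Π-suc p)

mutual
  QF⇒Σ : ∀ m {φ} → QF φ → Σ-form m φ
  QF⇒Σ zero    q = Σ0 q
  QF⇒Σ (suc m) q = Σ-Π (QF⇒Π m q)

  QF⇒Π : ∀ m {φ} → QF φ → Π-form m φ
  QF⇒Π zero    q = Π0 q
  QF⇒Π (suc m) q = Π-Σ (QF⇒Σ m q)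

mutual
  guard-Σ : ∀ {m D A} → QF D → Σ-form m A → Σ-form m (guard D A)
  guard-Σ d (Σ0 q)  = Σ0 (subst QF (sym (guard-QF q)) (qf-⇒ d q))
  guard-Σ d (Σ-Π p) = Σ-Π (guard-Π d p)
  guard-Σ d (Σ-∃ s) = Σ-∃ (guard-Σ (QF-substF ↑ d) s)

  guard-Π : ∀ {m D A} → QF D → Π-form m A → Π-form m (guard D A)
  guard-Π d (Π0 q)  = Π0 (subst QF (sym (guard-QF q)) (qf-⇒ d q))
  guard-Π d (Π-Σ s) = Π-Σ (guard-Σ d s)
  guard-Π d (Π-∀ p) = Π-∀ (guard-Π (QF-substF ↑ d) p)

QF-neg : ∀ {A} → QF A → QF (neg A)
QF-neg q = subst QF (sym (neg-QF q)) (qf-⇒ q qf-⊥)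

mutual
  neg-Σ : ∀ {m A} → Σ-form m A → Π-form m (neg A)
  neg-Σ (Σ0 q)  = Π0 (QF-neg q)
  neg-Σ (Σ-Π p) = Π-Σ (neg-Π p)
  neg-Σ (Σ-∃ s) = Π-∀ (neg-Σ s)

  neg-Π : ∀ {m A} → Π-form m A → Σ-form m (neg A)
  neg-Π (Π0 q)  = Σ0 (QF-neg q)
  neg-Π (Π-Σ s) = Σ-Π (neg-Σ s)
  neg-Π (Π-∀ p) = Σ-∃ (neg-Π p)

module Derivations (T : Theory) where

  infixr 9 _∘⇒_
  infix  3 _⇔_

  ⇒-refl : ∀ {A} → T ⊢ A ⇒ A
  ⇒-refl {A} = mp (mp (S {φ = A} {ψ = A ⇒ A} {χ = A}) K) (K {ψ = A})

  ⇒-ap : ∀ {A B C} → T ⊢ A ⇒ B ⇒ C → T ⊢ A ⇒ B → T ⊢ A ⇒ C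
  ⇒-ap f g = mp (mp S f) g

  ⇒-postcompose : ∀ {A B C} → T ⊢ B ⇒ C → T ⊢ (A ⇒ B) ⇒ (A ⇒ C)
  ⇒-postcompose f = mp S (mp K f)

  _∘⇒_ : ∀ {A B C} → T ⊢ B ⇒ C → T ⊢ A ⇒ B → T ⊢ A ⇒ C
  g ∘⇒ f = mp (⇒-postcompose g) f

  ⇒-pair : ∀ {A B C} → T ⊢ A ⇒ B → T ⊢ A ⇒ C → T ⊢ A ⇒ B ∧' C
  ⇒-pair f g = ⇒-ap (∧I ∘⇒ f) g

  ⇒-curry : ∀ {A B C} → T ⊢ A ∧' B ⇒ C → T ⊢ A ⇒ B ⇒ C
  ⇒-curry f = ⇒-postcompose f ∘⇒ ∧I

  ⇒-uncurry : ∀ {A B C} → T ⊢ A ⇒ B ⇒ C → T ⊢ A ∧' B ⇒ C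
  ⇒-uncurry f = ⇒-ap (f ∘⇒ ∧E₁) ∧E₂

  ∧-swap : ∀ {A B} → T ⊢ A ∧' B ⇒ B ∧' A
  ∧-swap = ⇒-pair ∧E₂ ∧E₁

  ∧-map : ∀ {A B A′ B′} → T ⊢ A ⇒ A′ → T ⊢ B ⇒ B′ → T ⊢ A ∧' B ⇒ A′ ∧' B′
  ∧-map f g = ⇒-pair (f ∘⇒ ∧E₁) (g ∘⇒ ∧E₂)

  ⇒-flip : ∀ {A B C} → T ⊢ A ⇒ B ⇒ C → T ⊢ B ⇒ A ⇒ C
  ⇒-flip f = ⇒-curry (⇒-uncurry f ∘⇒ ∧-swap)

  ∨-case : ∀ {A B C} → T ⊢ A ⇒ C → T ⊢ B ⇒ C → T ⊢ A ∨' B ⇒ C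
  ∨-case f g = mp (mp ∨E f) g

  ¬-elim : ∀ {A B} → T ⊢ ¬' A ⇒ A ⇒ B
  ¬-elim = ⇒-curry (efq ∘⇒ ⇒-ap ∧E₁ ∧E₂)

  contrapose : ∀ {A B} → T ⊢ A ⇒ B → T ⊢ ¬' B ⇒ ¬' A
  contrapose f = ⇒-curry (⇒-ap ∧E₁ (f ∘⇒ ∧E₂))

  ¬¬-intro : ∀ {A} → T ⊢ A → T ⊢ ¬' (¬' A)
  ¬¬-intro a = mp (mp S ⇒-refl) (mp K a)

  ¬⇒-self⇒¬¬ : ∀ {A} → T ⊢ ¬' A ⇒ A → T ⊢ ¬' (¬' A)
  ¬⇒-self⇒¬¬ f = ⇒-ap ⇒-refl f

  ¬¬-lem : ∀ {A} → T ⊢ ¬' (¬' (A ∨' ¬' A))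
  ¬¬-lem = ¬⇒-self⇒¬¬ (∨I₂ ∘⇒ contrapose ∨I₁)

  lem⇒dne : ∀ {A} → T ⊢ A ∨' ¬' A → T ⊢ ¬' (¬' A) ⇒ A
  lem⇒dne lem = mp (∨-case K (⇒-flip ¬-elim)) lem

  instantiate : ∀ {A} → T ⊢ A → (t : Term) → T ⊢ A [ t ]
  instantiate a t = mp (∀E t) (gen a)

  ∃-intro₀ : ∀ {A} → T ⊢ A ⇒ shiftF (∃' A)
  ∃-intro₀ {A} = subst (λ B → T ⊢ B ⇒ ∃' (substF (lift ↑) A)) (lift↑-[var0] A) (∃I (var 0))

  ∀-elim₀ : ∀ {A} → T ⊢ shiftF (∀' A) ⇒ A
  ∀-elim₀ {A} = subst (λ B → T ⊢ ∀' (substF (lift ↑) A) ⇒ B) (lift↑-[var0] A) (∀E (var 0))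

  ∃-cong : ∀ {A B} → T ⊢ A ⇒ B → T ⊢ ∃' A ⇒ ∃' B
  ∃-cong f = ∃E (∃-intro₀ ∘⇒ f)

  ∀-cong : ∀ {A B} → T ⊢ A ⇒ B → T ⊢ ∀' A ⇒ ∀' B
  ∀-cong f = ∀I (f ∘⇒ ∀-elim₀)

  _⇔_ : Formula → Formula → Set
  A ⇔ B = (T ⊢ A ⇒ B) × (T ⊢ B ⇒ A)

  guard-elim : ∀ D A → T ⊢ guard D A ⇒ D ⇒ A
  guard-elim D (∃' A)   = ∃E (⇒-postcompose ∃-intro₀ ∘⇒ guard-elim (shiftF D) A)
  guard-elim D (∀' A)   = ⇒-curry (∀I (⇒-uncurry (guard-elim (shiftF D) A ∘⇒ ∀-elim₀)))
  guard-elim D (t ≐ s)  = ⇒-refl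
  guard-elim D ⊥'       = ⇒-refl
  guard-elim D (A ∧' B) = ⇒-refl
  guard-elim D (A ∨' B) = ⇒-refl
  guard-elim D (A ⇒ B)  = ⇒-refl

  guard-intro : ∀ D A → T ⊢ A ⇒ guard D A
  guard-intro D (∃' A)   = ∃-cong (guard-intro (shiftF D) A)
  guard-intro D (∀' A)   = ∀-cong (guard-intro (shiftF D) A)
  guard-intro D (t ≐ s)  = K
  guard-intro D ⊥'       = K
  guard-intro D (A ∧' B) = K
  guard-intro D (A ∨' B) = K
  guard-intro D (A ⇒ B)  = K

  guard-vacuous : ∀ D A → T ⊢ ¬' D ⇒ guard D A
  guard-vacuous D (∃' A) = ∃I 𝟘 ∘⇒ subst (λ B → T ⊢ B ⇒ guard (shiftF D) A [ 𝟘 ])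
    (cong ¬' (shiftF-[] D 𝟘)) (instantiate (guard-vacuous (shiftF D) A) 𝟘)
  guard-vacuous D (∀' A)   = ∀I (guard-vacuous (shiftF D) A)
  guard-vacuous D (t ≐ s)  = ¬-elim
  guard-vacuous D ⊥'       = ¬-elim
  guard-vacuous D (A ∧' B) = ¬-elim
  guard-vacuous D (A ∨' B) = ¬-elim
  guard-vacuous D (A ⇒ B)  = ¬-elim

  neg⇒¬ : ∀ A → T ⊢ neg A ⇒ ¬' A
  neg⇒¬ (∃' A)   = ⇒-flip (∃E (⇒-flip (neg⇒¬ A ∘⇒ ∀-elim₀)))
  neg⇒¬ (∀' A)   = ∃E (contrapose ∀-elim₀ ∘⇒ neg⇒¬ A)
  neg⇒¬ (t ≐ s)  = ⇒-refl
  neg⇒¬ ⊥'       = ⇒-refl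
  neg⇒¬ (A ∧' B) = ⇒-refl
  neg⇒¬ (A ∨' B) = ⇒-refl
  neg⇒¬ (A ⇒ B)  = ⇒-refl

  QF-LEM : Set
  QF-LEM = ∀ {χ} → QF χ → T ⊢ χ ∨' ¬' χ

  neg-neg-QF : QF-LEM → ∀ {A} → QF A → T ⊢ neg (neg A) ⇒ A
  neg-neg-QF lem q rewrite neg-QF q = lem⇒dne (lem q)

  mutual
    neg-neg-Σ : QF-LEM → ∀ {m A} → Σ-form m A → T ⊢ neg (neg A) ⇒ A
    neg-neg-Σ lem (Σ0 q)  = neg-neg-QF lem q
    neg-neg-Σ lem (Σ-Π p) = neg-neg-Π lem p
    neg-neg-Σ lem (Σ-∃ s) = ∃-cong (neg-neg-Σ lem s)

    neg-neg-Π : QF-LEM → ∀ {m A} → Π-form m A → T ⊢ neg (neg A) ⇒ A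
    neg-neg-Π lem (Π0 q)  = neg-neg-QF lem q
    neg-neg-Π lem (Π-Σ s) = neg-neg-Σ lem s
    neg-neg-Π lem (Π-∀ p) = ∀-cong (neg-neg-Π lem p)

  ⇔-refl : ∀ {A} → A ⇔ A
  ⇔-refl = ⇒-refl , ⇒-refl

  ⇔-trans : ∀ {A B C} → A ⇔ B → B ⇔ C → A ⇔ C
  ⇔-trans (f , f′) (g , g′) = g ∘⇒ f , f′ ∘⇒ g′

  ∧-comm : ∀ {A B} → A ∧' B ⇔ B ∧' A
  ∧-comm = ∧-swap , ∧-swap

  ∃-cong⇔ : ∀ {A B} → A ⇔ B → ∃' A ⇔ ∃' B
  ∃-cong⇔ (f , f′) = ∃-cong f , ∃-cong f′

  ∀-cong⇔ : ∀ {A B} → A ⇔ B → ∀' A ⇔ ∀' B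
  ∀-cong⇔ (f , f′) = ∀-cong f , ∀-cong f′

  ∃-∧-distribʳ : ∀ {A B} → ∃' A ∧' B ⇔ ∃' (A ∧' shiftF B)
  ∃-∧-distribʳ = ⇒-uncurry (∃E (⇒-curry ∃-intro₀)) , ∃E (∧-map ∃-intro₀ ⇒-refl)

  ∃-∧-distribˡ : ∀ {A B} → A ∧' ∃' B ⇔ ∃' (shiftF A ∧' B)
  ∃-∧-distribˡ = ⇔-trans ∧-comm (⇔-trans ∃-∧-distribʳ (∃-cong⇔ ∧-comm))

  ∀-∧-distribʳ : ∀ {A B} → ∀' A ∧' B ⇔ ∀' (A ∧' shiftF B)
  ∀-∧-distribʳ {A} {B} = ∀I (∧-map ∀-elim₀ ⇒-refl) ,
    ⇒-pair (∀-cong ∧E₁) (subst (λ C → T ⊢ ∀' (A ∧' shiftF B) ⇒ C) (shiftF-[] B 𝟘) (∧E₂ ∘⇒ ∀E 𝟘))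

  ∀-∧-distribˡ : ∀ {A B} → A ∧' ∀' B ⇔ ∀' (shiftF A ∧' B)
  ∀-∧-distribˡ = ⇔-trans ∧-comm (⇔-trans ∀-∧-distribʳ (∀-cong⇔ ∧-comm))

  ProvablyΣ : ℕ → Formula → Set
  ProvablyΣ m A = ∃[ C ] (Σ-form m C × A ⇔ C)

  ProvablyΠ : ℕ → Formula → Set
  ProvablyΠ m A = ∃[ C ] (Π-form m C × A ⇔ C)

  ProvablyΣ-resp : ∀ {m A B} → A ⇔ B → ProvablyΣ m B → ProvablyΣ m A
  ProvablyΣ-resp e (C , c , e′) = C , c , ⇔-trans e e′

  ProvablyΠ-resp : ∀ {m A B} → A ⇔ B → ProvablyΠ m B → ProvablyΠ m A
  ProvablyΠ-resp e (C , c , e′) = C , c , ⇔-trans e e′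

  ProvablyΣ-∃ : ∀ {m A} → ProvablyΣ (suc m) A → ProvablyΣ (suc m) (∃' A)
  ProvablyΣ-∃ (C , c , e) = ∃' C , Σ-∃ c , ∃-cong⇔ e

  ProvablyΠ-∀ : ∀ {m A} → ProvablyΠ (suc m) A → ProvablyΠ (suc m) (∀' A)
  ProvablyΠ-∀ (C , c , e) = ∀' C , Π-∀ c , ∀-cong⇔ e

  ProvablyΠ⇒Σ : ∀ {m A} → ProvablyΠ m A → ProvablyΣ (suc m) A
  ProvablyΠ⇒Σ (C , c , e) = C , Σ-Π c , e

  ProvablyΣ⇒Π : ∀ {m A} → ProvablyΣ m A → ProvablyΠ (suc m) A
  ProvablyΣ⇒Π (C , c , e) = C , Π-Σ c , e

  mutual
    ∧-Σ : ∀ m {A B} → Σ-form m A → Σ-form m B → ProvablyΣ m (A ∧' B)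
    ∧-Σ zero    (Σ0 a)  (Σ0 b) = _ , Σ0 (qf-∧ a b) , ⇔-refl
    ∧-Σ (suc m) (Σ-∃ a) b      =
      ProvablyΣ-resp ∃-∧-distribʳ (ProvablyΣ-∃ (∧-Σ (suc m) a (Σ-substF ↑ b)))
    ∧-Σ (suc m) (Σ-Π a) b      = ∧-ΠΣ m a b

    ∧-ΠΣ : ∀ m {A B} → Π-form m A → Σ-form (suc m) B → ProvablyΣ (suc m) (A ∧' B)
    ∧-ΠΣ m a (Σ-∃ b) =
      ProvablyΣ-resp ∃-∧-distribˡ (ProvablyΣ-∃ (∧-ΠΣ m (Π-substF ↑ a) b))
    ∧-ΠΣ m a (Σ-Π b) = ProvablyΠ⇒Σ (∧-Π m a b)

    ∧-Π : ∀ m {A B} → Π-form m A → Π-form m B → ProvablyΠ m (A ∧' B)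
    ∧-Π zero    (Π0 a)  (Π0 b) = _ , Π0 (qf-∧ a b) , ⇔-refl
    ∧-Π (suc m) (Π-∀ a) b      =
      ProvablyΠ-resp ∀-∧-distribʳ (ProvablyΠ-∀ (∧-Π (suc m) a (Π-substF ↑ b)))
    ∧-Π (suc m) (Π-Σ a) b      = ∧-ΣΠ m a b

    ∧-ΣΠ : ∀ m {A B} → Σ-form m A → Π-form (suc m) B → ProvablyΠ (suc m) (A ∧' B)
    ∧-ΣΠ m a (Π-∀ b) =
      ProvablyΠ-resp ∀-∧-distribˡ (ProvablyΠ-∀ (∧-ΣΠ m (Σ-substF ↑ a) b))
    ∧-ΣΠ m a (Π-Σ b) = ProvablyΣ⇒Π (∧-Σ m a b)

  DNE-R-ProvablyΣ : ∀ {m A} → ClosedDNE-R T (Σ-form m) → ProvablyΣ m A →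
                    T ⊢ ¬' (¬' A) → T ⊢ A
  DNE-R-ProvablyΣ dne (C , c , to , from) ¬¬A =
    mp from (dne C c (mp (contrapose (contrapose to)) ¬¬A))

  DNE-R⇒QF-LEM : ∀ {m} → ClosedDNE-R T (Σ-form m) → QF-LEM
  DNE-R⇒QF-LEM {m} dne q = dne _ (QF⇒Σ m (qf-∨ q (qf-⇒ q qf-⊥))) ¬¬-lem

  DNE-R-pred : ∀ {m} → ClosedDNE-R T (Σ-form (suc m)) → ClosedDNE-R T (Σ-form m)
  DNE-R-pred dne φ s = dne φ (Σ-suc s)

  -- With x = var 0 and y = var 1: (x = 0 → P y) ∧ (x ≠ 0 → Q).
  select : Formula → Formula → Formula
  select P Q = guard (var 0 ≐ 𝟘) (shiftF P) ∧' guard (¬' (var 0 ≐ 𝟘)) (shiftF (shiftF Q))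

  select-[] : ∀ P Q t → select P Q [ t ] ≡ guard (t ≐ 𝟘) P ∧' guard (¬' (t ≐ 𝟘)) (shiftF Q)
  select-[] P Q t = cong₂ _∧'_
    (trans (substF-guard _ (var 0 ≐ 𝟘) (shiftF P)) (cong (guard (t ≐ 𝟘)) (shiftF-[] P t)))
    (trans (substF-guard _ (¬' (var 0 ≐ 𝟘)) (shiftF (shiftF Q)))
           (cong (guard (¬' (t ≐ 𝟘))) (shiftF-[] (shiftF Q) t)))

  select-Σ : ∀ {k P Q} → Σ-form (suc k) P → Π-form (suc k) Q →
             ProvablyΣ (suc (suc k)) (∃' (∃' (select P Q)))
  select-Σ {k} p q = ProvablyΣ-∃ (ProvablyΣ-∃ (∧-Σ (suc (suc k))
    (Σ-suc (guard-Σ qf-eq (Σ-substF ↑ p)))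
    (Σ-Π (guard-Π (qf-⇒ qf-eq qf-⊥) (Π-substF ↑ (Π-substF ↑ q))))))

  select-intro₁ : ∀ {P Q} → T ⊢ ∃' P ⇒ ∃' (∃' (select P Q))
  select-intro₁ {P} {Q} = ∃-cong (∃I 𝟘 ∘⇒ P⇒select[0])
    where
    P⇒select[0] : T ⊢ P ⇒ select P Q [ 𝟘 ]
    P⇒select[0] = subst (λ B → T ⊢ P ⇒ B) (sym (select-[] P Q 𝟘))
      (⇒-pair (guard-intro _ P) (guard-vacuous _ (shiftF Q) ∘⇒ mp K (¬¬-intro (refl≐ 𝟘))))

  select-intro₂ : ∀ {P Q} → ContainsHA T → T ⊢ Q ⇒ ∃' (∃' (select P Q))
  select-intro₂ {P} {Q} ha =
    ∃I 𝟘 ∘⇒ subst (λ B → T ⊢ B ⇒ ∃' (select P Q) [ 𝟘 ]) (shiftF-[] Q 𝟘)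
                  (instantiate (∃I (𝕊 𝟘) ∘⇒ shiftQ⇒select[1]) 𝟘)
    where
    shiftQ⇒select[1] : T ⊢ shiftF Q ⇒ select P Q [ 𝕊 𝟘 ]
    shiftQ⇒select[1] = subst (λ B → T ⊢ shiftF Q ⇒ B) (sym (select-[] P Q (𝕊 𝟘)))
      (⇒-pair (guard-vacuous _ P ∘⇒ mp K (ha _ (ax-succ≠0 𝟘))) (guard-intro _ (shiftF Q)))

  select-elim : ∀ {P Q} → T ⊢ (var 0 ≐ 𝟘) ∨' ¬' (var 0 ≐ 𝟘) →
                T ⊢ ∃' (∃' (select P Q)) ⇒ ∃' P ∨' Q
  select-elim {P} {Q} x≟0 = ∃E (∃E (mp (∨-case x≡0 x≢0) x≟0))
    where
    R : Formula
    R = shiftF (shiftF (∃' P ∨' Q))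
    shiftP⇒∃P : T ⊢ shiftF P ⇒ shiftF (shiftF (∃' P))
    shiftP⇒∃P = subst (λ B → T ⊢ B ⇒ shiftF (shiftF (∃' P))) (lift↑²-[var1] P) (∃I (var 1))
    x≡0 : T ⊢ (var 0 ≐ 𝟘) ⇒ select P Q ⇒ R
    x≡0 = ⇒-flip (⇒-postcompose (∨I₁ ∘⇒ shiftP⇒∃P) ∘⇒ guard-elim _ (shiftF P) ∘⇒ ∧E₁)
    x≢0 : T ⊢ ¬' (var 0 ≐ 𝟘) ⇒ select P Q ⇒ R
    x≢0 = ⇒-flip (⇒-postcompose ∨I₂ ∘⇒ guard-elim _ (shiftF (shiftF Q)) ∘⇒ ∧E₂)

  ¬∃⇒∀neg : ∀ {A} → T ⊢ A ∨' neg A → T ⊢ ¬' (∃' A) ⇒ ∀' (neg A)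
  ¬∃⇒∀neg lem = ∀I (mp (∨-case (⇒-flip ¬-elim ∘⇒ ∃-intro₀) K) lem)

  ∃-lem-neg : ∀ {k φ} → ContainsHA T → ClosedDNE-R T (Σ-form (suc (suc k))) →
              Σ-form (suc k) φ → T ⊢ φ ∨' neg φ → T ⊢ ∃' φ ∨' ∀' (neg φ)
  ∃-lem-neg {φ = φ} ha dne s lem =
    mp (select-elim (DNE-R⇒QF-LEM dne qf-eq))
       (DNE-R-ProvablyΣ dne (select-Σ s (Π-∀ (neg-Σ s))) ¬¬select)
    where
    ¬¬select : T ⊢ ¬' (¬' (∃' (∃' (select φ (∀' (neg φ))))))
    ¬¬select = ¬⇒-self⇒¬¬ (select-intro₂ ha ∘⇒ ¬∃⇒∀neg lem ∘⇒ contrapose select-intro₁)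

  lem-neg : ∀ k → ContainsHA T → ClosedDNE-R T (Σ-form (suc k)) →
            ∀ {φ} → Σ-form k φ → T ⊢ φ ∨' neg φ
  lem-neg zero    ha dne {φ} (Σ0 q) =
    subst (λ B → T ⊢ φ ∨' B) (sym (neg-QF q)) (DNE-R⇒QF-LEM dne q)
  lem-neg (suc k) ha dne (Σ-Π p)     =
    mp (∨-case ∨I₂ (∨I₁ ∘⇒ neg-neg-Π (DNE-R⇒QF-LEM dne) p))
       (lem-neg k ha (DNE-R-pred dne) (neg-Π p))
  lem-neg (suc k) ha dne (Σ-∃ s)     = ∃-lem-neg ha dne s (lem-neg (suc k) ha dne s)

lemma5p6 : (k : ℕ) (T : Theory) → ContainsHA T →
           ClosedDNE-R T (Σ-form (suc k)) → ProvesLEM T (Σ-form k)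
lemma5p6 k T ha dne φ s = mp (∨-case ∨I₁ (∨I₂ ∘⇒ neg⇒¬ φ)) (lem-neg k ha dne s)
  where open Derivations T
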